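{- Let $k\ge 2$ be an integer and let $f_k(z)=\sum_{n\ge1}\gamma_k(n)q^n$ be as in the context. Then for any prime $p>3$ and integer $r \geq 1$, $$\gamma_k(p)^r \equiv \gamma_{r(k-1)+1}(p) \pmod{p^{k-1}}.$$
   Context: For each integer $k\ge 2$, $f_k(z)=\sum_{n\ge1}\gamma_k(n)q^n$ is a weight $k$ newform with complex multiplication by $\mathbb{Q}(\sqrt{ -3})$, lying in $S_k(\Gamma_0(36))$ if $k\equiv 0,2 \pmod 6$, in $S_k(\Gamma_0(3),(\tfrac{ -3}{\cdot}))$ if $k\equiv 1\pmod 6$, in $S_k(\Gamma_0(12),(\tfrac{ -3}{\cdot}))$ if $k\equiv 3,5\pmod 6$, and in $S_k(\Gamma_0(9))$ if $k\equiv 4\pmod 6$, whose coefficients at odd primes $p$ are: $\gamma_k(p)=(a+b\sqrt{ -3})^{k-1}+(a-b\sqrt{ -3})^{k-1}$ if $p\equiv 1\pmod 6$, where $p=a^2+3b^2$ with integers $a\equiv 1\pmod 3$, $b>0$; $\gamma_k(3)=(-3)^{(k-1)/2}$ if $k$ is odd; and $\gamma_k(p)=0$ otherwise. -}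

module Defs where

open import Data.Nat as ℕ using (ℕ; zero; suc; _%_; _∸_)
open import Data.Integer as ℤ using (ℤ; +_; _+_; _-_; _*_; _<_; _^_)
open import Data.Integer.Divisibility as ℤD using ()
open import Data.Product using (_×_; _,_; Σ; ∃₂)
open import Data.Sum using (_⊎_)
open import Relation.Binary.PropositionalEquality using (_≡_)
open import Relation.Nullary using (¬_)

record ℤ√-3 : Set where
  constructor _+_√-3
  field
    re : ℤ
    im : ℤ
open ℤ√-3 public

_·_ : ℤ√-3 → ℤ√-3 → ℤ√-3
(x₁ + y₁ √-3) · (x₂ + y₂ √-3) =
  ((x₁ * x₂) - (+ 3 * (y₁ * y₂))) + ((x₁ * y₂) + (y₁ * x₂)) √-3

pow : ℤ√-3 → ℕ → ℤ√-3
pow z zero    = (+ 1) + (+ 0) √-3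
pow z (suc n) = z · pow z n

conj : ℤ√-3 → ℤ√-3
conj (x + y √-3) = x + (ℤ.- y) √-3

-- (a + b√-3)^n + (a - b√-3)^n  (an integer; the √-3 parts cancel)
traceSum : ℤ → ℤ → ℕ → ℤ
traceSum a b n = re (pow (a + b √-3) n) + re (pow (conj (a + b √-3)) n)

-- g is the function k ↦ γ_k(p) (for k ≥ 2) at a fixed prime p > 3,
-- as prescribed by the context.
IsGammaAtPrime : ℕ → (ℕ → ℤ) → Set
IsGammaAtPrime p g =
  (p % 6 ≡ 1 ×
     Σ ℤ λ a → Σ ℤ λ b →
       (+ p ≡ (a * a) + (+ 3 * (b * b))) × (a ℤ.% (+ 3) ≡ 1) × (+ 0 < b) ×
       (∀ k → 2 ℕ.≤ k → g k ≡ traceSum a b (k ∸ 1)))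
  ⊎ (¬ (p % 6 ≡ 1) × (∀ k → 2 ℕ.≤ k → g k ≡ + 0))

module Submission where

-- Write z = a + b√-3 with p = a² + 3b² = N(z), and put n = k - 1,
-- w = zⁿ.  Then γ_k(p) = w + w̄ and γ_{rn+1}(p) = wʳ + w̄ʳ, while pⁿ = N(w).
-- The power sums s_m = wᵐ + w̄ᵐ satisfy the linear recurrence
--   s_{m+2} = s₁ s_{m+1} - N(w) s_m,
-- so modulo N(w) they form a geometric sequence: s₁ʳ ≡ s_r (mod N(w)).  At inert primes
-- every γ_k(p) vanishes and the congruence is 0 ≡ 0.

open import Defs
open import Relation.Binary.PropositionalEquality

module Recurrence where

  open import Data.Nat using (ℕ; zero; suc)
  open import Data.Integer using (ℤ; 0ℤ; _+_; _-_; _*_; _^_)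
  open import Data.Integer.Properties using (*-zeroˡ; *-identityʳ; +-inverseʳ)
  open import Data.Integer.Divisibility.Signed
    using (_∣_; divides; ∣-refl; ∣m∣n⇒∣m+n; ∣n⇒∣m*n)
  open import Data.Integer.Tactic.RingSolver using (solve-∀)

  ∣0ℤ : ∀ N → N ∣ 0ℤ
  ∣0ℤ N = divides 0ℤ (sym (*-zeroˡ N))

  -- If s₁ = t and s_{m+2} = t s_{m+1} - N s_m, then s_{m+1} ≡ t^{m+1} (mod N):
  -- modulo N the recurrence degenerates to s_{m+2} ≡ t s_{m+1}.
  power-congruence : (s : ℕ → ℤ) (t N : ℤ) → s 1 ≡ t →
    (∀ m → s (suc (suc m)) ≡ t * s (suc m) - N * s m) →
    ∀ m → N ∣ t ^ suc m - s (suc m)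
  power-congruence s t N s₁≡t recurrence zero =
    subst (N ∣_) (sym t¹-s₁≡0) (∣0ℤ N)
    where
    t¹-s₁≡0 : t ^ 1 - s 1 ≡ 0ℤ
    t¹-s₁≡0 = trans (cong₂ _-_ (*-identityʳ t) s₁≡t) (+-inverseʳ t)
  power-congruence s t N s₁≡t recurrence (suc m) =
    subst (N ∣_) (sym split)
      (∣m∣n⇒∣m+n (∣n⇒∣m*n t (power-congruence s t N s₁≡t recurrence m))
                 (∣n⇒∣m*n (s m) ∣-refl))
    where
    regroup : ∀ t P A N B → t * P - (t * A - N * B) ≡ t * (P - A) + B * N
    regroup = solve-∀

    split : t ^ suc (suc m) - s (suc (suc m))
          ≡ t * (t ^ suc m - s (suc m)) + s m * N
    split = trans (cong (t ^ suc (suc m) -_) (recurrence m))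
                  (regroup t (t ^ suc m) (s (suc m)) N (s m))

module Arithmetic where

  open import Data.Nat using (zero; suc)
  import Data.Nat as ℕ
  open import Data.Integer using (ℤ; +_; -_; _+_; _-_; _*_; _^_)
  open import Data.Integer.Divisibility.Signed using (_∣_)
  open import Data.Integer.Tactic.RingSolver using (solve-∀)
  open Recurrence using (power-congruence)

  one : ℤ√-3
  one = (+ 1) + (+ 0) √-3

  -- The norm N(x + y√-3) = x² + 3y² = w w̄ and the trace w + w̄ = 2x.
  norm : ℤ√-3 → ℤ
  norm (x + y √-3) = x * x + + 3 * (y * y)

  trace : ℤ√-3 → ℤ
  trace w = re w + re w

  ·-identityˡ : ∀ w → one · w ≡ w
  ·-identityˡ (x + y √-3) = cong₂ _+_√-3 (left x y) (right x y)
    where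
    left : ∀ x y → + 1 * x - + 3 * (+ 0 * y) ≡ x
    left = solve-∀
    right : ∀ x y → + 1 * y + + 0 * x ≡ y
    right = solve-∀

  ·-identityʳ : ∀ w → w · one ≡ w
  ·-identityʳ (x + y √-3) = cong₂ _+_√-3 (left x y) (right x y)
    where
    left : ∀ x y → x * + 1 - + 3 * (y * + 0) ≡ x
    left = solve-∀
    right : ∀ x y → x * + 0 + y * + 1 ≡ y
    right = solve-∀

  ·-assoc : ∀ u v w → u · (v · w) ≡ (u · v) · w
  ·-assoc (a + b √-3) (c + d √-3) (e + f √-3) =
    cong₂ _+_√-3 (left a b c d e f) (right a b c d e f)
    where
    left : ∀ a b c d e f →
      a * (c * e - + 3 * (d * f)) - + 3 * (b * (c * f + d * e))
      ≡ (a * c - + 3 * (b * d)) * e - + 3 * ((a * d + b * c) * f)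
    left = solve-∀
    right : ∀ a b c d e f →
      a * (c * f + d * e) + b * (c * e - + 3 * (d * f))
      ≡ (a * c - + 3 * (b * d)) * f + (a * d + b * c) * e
    right = solve-∀

  conj-· : ∀ v w → conj (v · w) ≡ conj v · conj w
  conj-· (a + b √-3) (c + d √-3) = cong₂ _+_√-3 (left a b c d) (right a b c d)
    where
    left : ∀ a b c d → a * c - + 3 * (b * d) ≡ a * c - + 3 * (- b * - d)
    left = solve-∀
    right : ∀ a b c d → - (a * d + b * c) ≡ a * - d + - b * c
    right = solve-∀

  norm-· : ∀ v w → norm (v · w) ≡ norm v * norm w
  norm-· (a + b √-3) (c + d √-3) = identity a b c d
    where
    identity : ∀ a b c d →
      (a * c - + 3 * (b * d)) * (a * c - + 3 * (b * d))
        + + 3 * ((a * d + b * c) * (a * d + b * c))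
      ≡ (a * a + + 3 * (b * b)) * (c * c + + 3 * (d * d))
    identity = solve-∀

  -- w² = (w + w̄) w - w w̄, hence tr(w² c) = tr(w) tr(w c) - N(w) tr(c).
  trace-step : ∀ w c → trace (w · (w · c)) ≡ trace w * trace (w · c) - norm w * trace c
  trace-step (u + v √-3) (x + y √-3) = identity u v x y
    where
    identity : ∀ u v x y →
      (u * (u * x - + 3 * (v * y)) - + 3 * (v * (u * y + v * x)))
        + (u * (u * x - + 3 * (v * y)) - + 3 * (v * (u * y + v * x)))
      ≡ (u + u) * ((u * x - + 3 * (v * y)) + (u * x - + 3 * (v * y)))
        - (u * u + + 3 * (v * v)) * (x + x)
    identity = solve-∀

  pow-+ : ∀ z m n → pow z (m ℕ.+ n) ≡ pow z m · pow z n
  pow-+ z zero    n = sym (·-identityˡ (pow z n))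
  pow-+ z (suc m) n = trans (cong (z ·_) (pow-+ z m n)) (·-assoc z (pow z m) (pow z n))

  pow-* : ∀ z r n → pow z (r ℕ.* n) ≡ pow (pow z n) r
  pow-* z zero    n = refl
  pow-* z (suc r) n = trans (pow-+ z n (r ℕ.* n)) (cong (pow z n ·_) (pow-* z r n))

  pow-conj : ∀ z n → pow (conj z) n ≡ conj (pow z n)
  pow-conj z zero    = refl
  pow-conj z (suc n) = trans (cong (conj z ·_) (pow-conj z n)) (sym (conj-· z (pow z n)))

  norm-pow : ∀ z n → norm (pow z n) ≡ norm z ^ n
  norm-pow z zero    = refl
  norm-pow z (suc n) = trans (norm-· z (pow z n)) (cong (norm z *_) (norm-pow z n))

  -- traceSum a b m is the trace of (a + b√-3)ᵐ, since conjugation commutes with powers.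
  traceSum≡trace : ∀ a b m → traceSum a b m ≡ trace (pow (a + b √-3) m)
  traceSum≡trace a b m = cong (λ w → re (pow (a + b √-3) m) + re w) (pow-conj (a + b √-3) m)

  trace-power-congruence : ∀ w r → norm w ∣ trace w ^ suc r - trace (pow w (suc r))
  trace-power-congruence w =
    power-congruence (λ m → trace (pow w m)) (trace w) (norm w)
      (cong trace (·-identityʳ w)) (λ m → trace-step w (pow w m))

  traceSum-power-congruence : ∀ a b n r →
    (a * a + + 3 * (b * b)) ^ n ∣ traceSum a b n ^ suc r - traceSum a b (suc r ℕ.* n)
  traceSum-power-congruence a b n r =
    subst₂ _∣_ (norm-pow z n)
      (sym (cong₂ (λ s t → s ^ suc r - t)
             (traceSum≡trace a b n)
             (trans (traceSum≡trace a b (suc r ℕ.* n)) (cong trace (pow-* z (suc r) n)))))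
      (trace-power-congruence (pow z n) r)
    where
    z : ℤ√-3
    z = a + b √-3

-- Natural-number arithmetic is opened only from here on, so that the ℤ[√-3]
-- development above can use the integer operators unqualified.
open import Data.Nat using (ℕ; _≤_; _<_; _*_; _+_; _∸_)
open import Data.Nat.Primality using (Prime)
open import Data.Integer using (ℤ; +_; _-_; _^_)
open import Data.Integer.Divisibility using (_∣_)

open import Data.Nat using (suc)
open import Data.Nat.Properties using (∸-monoˡ-≤; *-mono-≤; +-monoˡ-≤; m+n∸n≡m)
import Data.Nat.Divisibility as ℕ
open import Data.Integer.Properties using (*-zeroˡ)
open import Data.Integer using (∣_∣)
open import Data.Integer.Divisibility.Signed using (∣⇒∣ᵤ) renaming (_∣_ to _∣ₛ_)
open import Data.Sum using (inj₁; inj₂)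
open import Data.Product using (_,_)
open Arithmetic using (traceSum-power-congruence)

weights-to-exponents : (g h : ℕ → ℤ) → (∀ k → 2 ≤ k → g k ≡ h (k ∸ 1)) →
  ∀ k r → 2 ≤ k → 1 ≤ r →
  g k ^ r - g (r * (k ∸ 1) + 1) ≡ h (k ∸ 1) ^ r - h (r * (k ∸ 1))
weights-to-exponents g h g≡h k r 2≤k 1≤r =
  cong₂ (λ s t → s ^ r - t) (g≡h k 2≤k)
    (trans (g≡h (r * n + 1) 2≤rn+1) (cong h (m+n∸n≡m (r * n) 1)))
  where
  n : ℕ
  n = k ∸ 1
  2≤rn+1 : 2 ≤ r * n + 1
  2≤rn+1 = +-monoˡ-≤ 1 (*-mono-≤ 1≤r (∸-monoˡ-≤ 1 2≤k))

corollary1p3 : (k p r : ℕ) → 2 ≤ k → Prime p → 3 < p → 1 ≤ r →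
    (γ : ℕ → ℤ) → IsGammaAtPrime p γ →
    ((+ p) ^ (k ∸ 1)) ∣ ((γ k ^ r) - γ ((r * (k ∸ 1)) + 1))
-- Split prime p = a² + 3b²: the congruence for traceSum, with N(a + b√-3) = p.
corollary1p3 k p (suc r) 2≤k _ _ 1≤r γ (inj₁ (_ , a , b , p≡norm , _ , _ , γ≡traceSum)) =
  ∣⇒∣ᵤ (subst₂ _∣ₛ_
    (cong (_^ (k ∸ 1)) (sym p≡norm))
    (sym (weights-to-exponents γ (traceSum a b) γ≡traceSum k (suc r) 2≤k 1≤r))
    (traceSum-power-congruence a b (k ∸ 1) r))
-- Inert prime: both sides vanish.
corollary1p3 k p (suc r) 2≤k _ _ 1≤r γ (inj₂ (_ , γ≡0)) =
  subst (λ d → (+ p) ^ (k ∸ 1) ∣ d)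
    (sym (trans (weights-to-exponents γ (λ _ → + 0) γ≡0 k (suc r) 2≤k 1≤r)
                (cong (_- + 0) (*-zeroˡ ((+ 0) ^ r)))))
    (ℕ._∣0 (∣_∣ ((+ p) ^ (k ∸ 1))))
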